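{- Let $G$ be a graph whose vertex set can be partitioned into two sets $L$ and $R$ such that every vertex of $L$ is adjacent to every vertex of $R$. Then $G$ is an OAT graph if and only if $G[L]$ is an OAT graph and $G[R]$ is an OAT graph.
   Context: All graphs are finite and simple; $G[X]$ is the subgraph induced by $X$. For non-adjacent vertices $u,v$, $u$ is comparable to $v$ if $N(u)\subseteq N(v)$. A graph is an OAT graph if it can be constructed from single-vertex graphs by a finite sequence of the following operations, where $G_1=(V_1,E_1)$, $G_2=(V_2,E_2)$ are vertex-disjoint OAT graphs: (1) disjoint union $(V_1\cup V_2,E_1\cup E_2)$; (2) join $(V_1\cup V_2, E_1\cup E_2\cup\{xy: x\in V_1,y\in V_2\})$; (3) adding a comparable vertex: for $v\in V_1$ and a new vertex $u\notin V_1$, form $(V_1\cup\{u\}, E_1\cup\{ux: x\in X\})$ for some $X\subseteq N(v)$; (4) attaching a clique: for a complete graph $Q=(V_Q,E_Q)$ disjoint from $G_1$ and $v\in V_1$, form $(V_1\cup V_Q, E_1\cup E_Q\cup\{qv: q\in V_Q\})$. -}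

module Defs where

open import Level using (0ℓ)
open import Data.Nat using (ℕ; suc)
open import Data.Fin using (Fin)
open import Data.Bool using (Bool; true; false; T; not)
open import Data.Unit using (⊤; tt)
open import Data.Empty using (⊥)
open import Data.Product using (Σ; _,_; proj₁; proj₂)
open import Data.Sum using (_⊎_; inj₁; inj₂)
open import Data.Maybe using (Maybe; just; nothing)
open import Relation.Nullary using (¬_; Dec; yes; no)
open import Relation.Binary.PropositionalEquality using (_≡_)
open import Relation.Binary.Definitions using (DecidableEquality)
import Data.Sum.Properties as SumP
import Data.Maybe.Properties as MaybeP
import Data.Fin.Properties as FinP
import Data.Unit.Properties as UnitP
open import Relation.Nullary using (¬?)
open import Function.Bundles using (_↔_; _⇔_; Inverse)

-- A simple graph: vertex type, symmetric irreflexive decidable adjacency.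
-- (Finiteness is imposed separately where needed; OAT graphs are finite
-- automatically.)
record Graph : Set₁ where
  field
    V      : Set
    E      : V → V → Set
    sym    : ∀ {x y} → E x y → E y x
    irrefl : ∀ {x} → ¬ E x x
    dec    : ∀ x y → Dec (E x y)
    deq    : DecidableEquality V
open Graph public

Finite : Graph → Set
Finite G = Σ ℕ λ n → Fin n ↔ V G

record _≅_ (G H : Graph) : Set where
  field
    bij   : V G ↔ V H
    preserves : ∀ x y → E G x y ⇔ E H (Inverse.to bij x) (Inverse.to bij y)

K₁ : Graph
K₁ = record { V = ⊤ ; E = λ _ _ → ⊥ ; sym = λ () ; irrefl = λ () ; dec = λ _ _ → no λ () ; deq = UnitP._≟_ }

_⊕_ : Graph → Graph → Graph
G ⊕ H = record { V = V G ⊎ V H ; E = Eu ; sym = λ {x} {y} → s {x} {y} ; irrefl = λ {x} → i {x} ; dec = d ; deq = SumP.≡-dec (deq G) (deq H) }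
  where
  Eu : V G ⊎ V H → V G ⊎ V H → Set
  Eu (inj₁ x) (inj₁ y) = E G x y
  Eu (inj₂ x) (inj₂ y) = E H x y
  Eu _ _ = ⊥
  s : ∀ {x y} → Eu x y → Eu y x
  s {inj₁ x} {inj₁ y} e = sym G e
  s {inj₂ x} {inj₂ y} e = sym H e
  i : ∀ {x} → ¬ Eu x x
  i {inj₁ x} = irrefl G
  i {inj₂ x} = irrefl H
  d : ∀ x y → Dec (Eu x y)
  d (inj₁ x) (inj₁ y) = dec G x y
  d (inj₁ x) (inj₂ y) = no λ ()
  d (inj₂ x) (inj₁ y) = no λ ()
  d (inj₂ x) (inj₂ y) = dec H x y

_⊗_ : Graph → Graph → Graph
G ⊗ H = record { V = V G ⊎ V H ; E = Ej ; sym = λ {x} {y} → s {x} {y} ; irrefl = λ {x} → i {x} ; dec = d ; deq = SumP.≡-dec (deq G) (deq H) }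
  where
  Ej : V G ⊎ V H → V G ⊎ V H → Set
  Ej (inj₁ x) (inj₁ y) = E G x y
  Ej (inj₂ x) (inj₂ y) = E H x y
  Ej _ _ = ⊤
  s : ∀ {x y} → Ej x y → Ej y x
  s {inj₁ x} {inj₁ y} e = sym G e
  s {inj₁ x} {inj₂ y} e = tt
  s {inj₂ x} {inj₁ y} e = tt
  s {inj₂ x} {inj₂ y} e = sym H e
  i : ∀ {x} → ¬ Ej x x
  i {inj₁ x} = irrefl G
  i {inj₂ x} = irrefl H
  d : ∀ x y → Dec (Ej x y)
  d (inj₁ x) (inj₁ y) = dec G x y
  d (inj₁ x) (inj₂ y) = yes tt
  d (inj₂ x) (inj₁ y) = yes tt
  d (inj₂ x) (inj₂ y) = dec H x y

addVertex : (G : Graph) → (V G → Bool) → Graph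
addVertex G X = record { V = Maybe (V G) ; E = Ea ; sym = λ {x} {y} → s {x} {y} ; irrefl = λ {x} → i {x} ; dec = d ; deq = MaybeP.≡-dec (deq G) }
  where
  Ea : Maybe (V G) → Maybe (V G) → Set
  Ea (just x) (just y) = E G x y
  Ea nothing (just y) = T (X y)
  Ea (just x) nothing = T (X x)
  Ea nothing nothing = ⊥
  s : ∀ {x y} → Ea x y → Ea y x
  s {just x} {just y} e = sym G e
  s {nothing} {just y} e = e
  s {just x} {nothing} e = e
  i : ∀ {x} → ¬ Ea x x
  i {just x} = irrefl G
  i {nothing} = λ ()
  dT : ∀ b → Dec (T b)
  dT true = yes tt
  dT false = no λ ()
  d : ∀ x y → Dec (Ea x y)
  d (just x) (just y) = dec G x y
  d nothing (just y) = dT (X y)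
  d (just x) nothing = dT (X x)
  d nothing nothing = no λ ()

-- Attach a complete graph on Fin (suc k) (a nonempty clique), every vertex
-- of which is joined to the vertex v.
attachClique : (G : Graph) → V G → ℕ → Graph
attachClique G v k = record { V = V G ⊎ Fin (suc k) ; E = Ec ; sym = λ {x} {y} → s {x} {y} ; irrefl = λ {x} → i {x} ; dec = d ; deq = SumP.≡-dec (deq G) FinP._≟_ }
  where
  Ec : V G ⊎ Fin (suc k) → V G ⊎ Fin (suc k) → Set
  Ec (inj₁ x) (inj₁ y) = E G x y
  Ec (inj₁ x) (inj₂ q) = x ≡ v
  Ec (inj₂ q) (inj₁ y) = y ≡ v
  Ec (inj₂ p) (inj₂ q) = ¬ (p ≡ q)
  s : ∀ {x y} → Ec x y → Ec y x
  s {inj₁ x} {inj₁ y} e = sym G e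
  s {inj₁ x} {inj₂ q} e = e
  s {inj₂ q} {inj₁ y} e = e
  s {inj₂ p} {inj₂ q} e = λ eq → e (Relation.Binary.PropositionalEquality.sym eq)
  i : ∀ {x} → ¬ Ec x x
  i {inj₁ x} = irrefl G
  i {inj₂ q} = λ f → f Relation.Binary.PropositionalEquality.refl
  d : ∀ x y → Dec (Ec x y)
  d (inj₁ x) (inj₁ y) = dec G x y
  d (inj₁ x) (inj₂ q) = deq G x v
  d (inj₂ q) (inj₁ y) = deq G y v
  d (inj₂ p) (inj₂ q) = ¬? (p FinP.≟ q)

induced : (G : Graph) → (V G → Bool) → Graph
induced G X = record
  { V = Σ (V G) (λ x → T (X x))
  ; E = λ a b → E G (proj₁ a) (proj₁ b)
  ; sym = λ {a} {b} → sym G {proj₁ a} {proj₁ b}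
  ; irrefl = λ {a} → irrefl G {proj₁ a}
  ; dec = λ a b → dec G (proj₁ a) (proj₁ b)
  ; deq = λ a b → dq a b }
  where
  Tprop : ∀ b (p q : T b) → p ≡ q
  Tprop true tt tt = Relation.Binary.PropositionalEquality.refl
  dq : DecidableEquality (Σ (V G) (λ x → T (X x)))
  dq (x , p) (y , q) with deq G x y
  ... | no x≢y = no λ { Relation.Binary.PropositionalEquality.refl → x≢y Relation.Binary.PropositionalEquality.refl }
  ... | yes Relation.Binary.PropositionalEquality.refl with Tprop (X x) p q
  ...   | Relation.Binary.PropositionalEquality.refl = yes Relation.Binary.PropositionalEquality.refl

-- Vertex-disjointness/choice of labels is handled by the canonical vertex
-- types above together with closure under isomorphism (relabelling).
data OAT : Graph → Set₁ where
  single : OAT K₁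
  union  : ∀ {G H} → OAT G → OAT H → OAT (G ⊕ H)
  join   : ∀ {G H} → OAT G → OAT H → OAT (G ⊗ H)
  comparable : ∀ {G} → OAT G → (v : V G) (X : V G → Bool) →
               (∀ x → T (X x) → E G v x) → OAT (addVertex G X)
  clique : ∀ {G} → OAT G → (v : V G) (k : ℕ) → OAT (attachClique G v k)
  relabel : ∀ {G H} → G ≅ H → OAT G → OAT H

module Submission where

-- (⇐) Since the cut is complete, G is the join G[L] ⊗ G[V ∖ L]
--     (join-decomposition), and OAT graphs are closed under joins.
-- (⇒) The key lemma induced-OAT⁰ says: if G is OAT and L is a complete cut,
--     then G[L] is OAT or empty.  It is proved by induction on the OAT
--     construction of G, after observing that taking induced subgraphs
--     commutes with union, join and relabelling, and analysing the two
--     remaining operations.  Adding a comparable vertex u (with N(u) ⊆ N(v))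
--     is harmless: u and v cannot be separated by a complete cut, because u is
--     not adjacent to v.  Attaching a clique Q at v yields G[L] with Q ∩ L
--     either attached at v (if v ∈ L) or as a separate complete component;
--     this step needs no hypothesis on L at all.

open import Defs
open import Data.Bool using (Bool; true; false; T; not; if_then_else_; T?)
open import Data.Bool.Properties using (T-irrelevant; not-involutive)
open import Data.Fin using (Fin; zero; suc)
import Data.Fin.Properties as FinP
open import Data.Maybe using (just; nothing)
open import Data.Nat using (ℕ; zero; suc)
open import Data.Product using (∃; _×_; Σ; _,_; proj₁)
open import Data.Sum using (_⊎_; inj₁; inj₂; [_,_])
import Data.Sum as Sum
open import Data.Sum.Function.Propositional using (_⊎-↔_)
open import Data.Unit using (⊤; tt)
open import Function using (_∘_; id)
open import Function.Bundles using (_⇔_; _↔_; Inverse; Injection; mk⇔; mk↔ₛ′; Equivalence)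
open import Function.Properties.Inverse using (↔-refl; ↔-sym; ↔-trans; ↔⇒↣)
open import Relation.Nullary using (¬_; ¬?; yes; no; contradiction)
open import Relation.Binary.PropositionalEquality as Eq using (_≡_; refl; cong; subst)

-- Subsets given by Boolean predicates.  Membership proofs are irrelevant, so
-- an element of a subset is determined by the underlying element.

Sub : {A : Set} → (A → Bool) → Set
Sub {A} P = Σ A (λ x → T (P x))

sub-≡ : {A : Set} {P : A → Bool} {x y : A} {p : T (P x)} {q : T (P y)} →
        x ≡ y → _≡_ {A = Sub P} (x , p) (y , q)
sub-≡ {x = x} refl = cong (x ,_) (T-irrelevant _ _)

T-or-not : ∀ b → T b ⊎ T (not b)
T-or-not true  = inj₁ tt
T-or-not false = inj₂ tt

T-or-not-true : ∀ b (p : T b) → T-or-not b ≡ inj₁ p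
T-or-not-true true tt = refl

T-or-not-false : ∀ b (q : T (not b)) → T-or-not b ≡ inj₂ q
T-or-not-false false tt = refl

partition↔ : {A : Set} (P : A → Bool) → (Sub P ⊎ Sub (not ∘ P)) ↔ A
partition↔ {A} P = mk↔ₛ′ [ proj₁ , proj₁ ] split merge-split split-merge
  where
  split : A → Sub P ⊎ Sub (not ∘ P)
  split x = Sum.map (x ,_) (x ,_) (T-or-not (P x))
  merge-split : ∀ x → [ proj₁ , proj₁ ] (split x) ≡ x
  merge-split x with T-or-not (P x)
  ... | inj₁ _ = refl
  ... | inj₂ _ = refl
  split-merge : ∀ s → split ([ proj₁ , proj₁ ] s) ≡ s
  split-merge (inj₁ (x , p)) = cong (Sum.map (x ,_) (x ,_)) (T-or-not-true (P x) p)
  split-merge (inj₂ (x , q)) = cong (Sum.map (x ,_) (x ,_)) (T-or-not-false (P x) q)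

Sub-⊎↔ : {A B : Set} (P : A ⊎ B → Bool) → (Sub (P ∘ inj₁) ⊎ Sub (P ∘ inj₂)) ↔ Sub P
Sub-⊎↔ {A} {B} P = mk↔ₛ′ merge split merge-split split-merge
  where
  merge : Sub (P ∘ inj₁) ⊎ Sub (P ∘ inj₂) → Sub P
  merge (inj₁ (x , p)) = inj₁ x , p
  merge (inj₂ (y , p)) = inj₂ y , p
  split : Sub P → Sub (P ∘ inj₁) ⊎ Sub (P ∘ inj₂)
  split (inj₁ x , p) = inj₁ (x , p)
  split (inj₂ y , p) = inj₂ (y , p)
  merge-split : ∀ s → merge (split s) ≡ s
  merge-split (inj₁ _ , _) = refl
  merge-split (inj₂ _ , _) = refl
  split-merge : ∀ s → split (merge s) ≡ s
  split-merge (inj₁ _) = refl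
  split-merge (inj₂ _) = refl

-- Counting: a decidable subset of Fin n is in bijection with some Fin m.
-- Needed to recognise the part of an attached clique lying in L as a clique.

T↔Fin : ∀ b → T b ↔ Fin (if b then 1 else 0)
T↔Fin true  = ↔-sym FinP.1↔⊤
T↔Fin false = ↔-sym FinP.0↔⊥

Sub-Fin-suc↔ : ∀ {n} (P : Fin (suc n) → Bool) → Sub P ↔ (T (P zero) ⊎ Sub (P ∘ suc))
Sub-Fin-suc↔ {n} P = mk↔ₛ′ split merge split-merge merge-split
  where
  split : Sub P → T (P zero) ⊎ Sub (P ∘ suc)
  split (zero  , p) = inj₁ p
  split (suc i , p) = inj₂ (i , p)
  merge : T (P zero) ⊎ Sub (P ∘ suc) → Sub P
  merge (inj₁ p)       = zero , p
  merge (inj₂ (i , p)) = suc i , p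
  split-merge : ∀ s → split (merge s) ≡ s
  split-merge (inj₁ _) = refl
  split-merge (inj₂ _) = refl
  merge-split : ∀ s → merge (split s) ≡ s
  merge-split (zero  , _) = refl
  merge-split (suc _ , _) = refl

count : ∀ n (P : Fin n → Bool) → Σ ℕ (λ m → Sub P ↔ Fin m)
count zero    P = 0 , mk↔ₛ′ (λ { (() , _) }) (λ ()) (λ ()) (λ { (() , _) })
count (suc n) P with count n (P ∘ suc)
... | m , ψ = _ , ↔-trans (Sub-Fin-suc↔ P)
                    (↔-trans (T↔Fin (P zero) ⊎-↔ ψ) (↔-sym FinP.+↔⊎))

mkIso : (G H : Graph) (β : V G ↔ V H) →
        (∀ x y → E G x y → E H (Inverse.to β x) (Inverse.to β y)) →
        (∀ x y → E H (Inverse.to β x) (Inverse.to β y) → E G x y) → G ≅ H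
mkIso G H β pres refl′ = record { bij = β ; preserves = λ x y → mk⇔ (pres x y) (refl′ x y) }

absorbʳ : {A B : Set} → ¬ B → A ↔ (A ⊎ B)
absorbʳ ¬b = mk↔ₛ′ inj₁ [ id , (λ b → contradiction b ¬b) ]
  (λ { (inj₁ _) → refl ; (inj₂ b) → contradiction b ¬b }) (λ _ → refl)

absorbˡ : {A B : Set} → ¬ A → B ↔ (A ⊎ B)
absorbˡ ¬a = mk↔ₛ′ inj₂ [ (λ a → contradiction a ¬a) , id ]
  (λ { (inj₁ a) → contradiction a ¬a ; (inj₂ _) → refl }) (λ _ → refl)

-- Induced subgraphs arising in the induction may be empty, which OAT graphs
-- never are; the class OAT⁰ adds the empty graphs and enjoys the same
-- closure properties under union, join and relabelling.

Empty : Graph → Set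
Empty G = ¬ V G

OAT⁰ : Graph → Set₁
OAT⁰ G = OAT G ⊎ Empty G

OAT⁰-nonempty : ∀ {G} → OAT⁰ G → V G → OAT G
OAT⁰-nonempty (inj₁ o) _ = o
OAT⁰-nonempty (inj₂ e) x = contradiction x e

OAT⁰-relabel : ∀ {G H} → G ≅ H → OAT⁰ G → OAT⁰ H
OAT⁰-relabel i (inj₁ o) = inj₁ (relabel i o)
OAT⁰-relabel i (inj₂ e) = inj₂ (e ∘ Inverse.from (_≅_.bij i))

OAT⁰-⊕ : ∀ {G H} → OAT⁰ G → OAT⁰ H → OAT⁰ (G ⊕ H)
OAT⁰-⊕         (inj₁ g) (inj₁ h) = inj₁ (union g h)
OAT⁰-⊕ {G} {H} (inj₁ g) (inj₂ e) =
  inj₁ (relabel (mkIso G (G ⊕ H) (absorbʳ e) (λ _ _ p → p) (λ _ _ p → p)) g)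
OAT⁰-⊕ {G} {H} (inj₂ e) (inj₁ h) =
  inj₁ (relabel (mkIso H (G ⊕ H) (absorbˡ e) (λ _ _ p → p) (λ _ _ p → p)) h)
OAT⁰-⊕         (inj₂ e) (inj₂ f) = inj₂ [ e , f ]

OAT⁰-⊗ : ∀ {G H} → OAT⁰ G → OAT⁰ H → OAT⁰ (G ⊗ H)
OAT⁰-⊗         (inj₁ g) (inj₁ h) = inj₁ (join g h)
OAT⁰-⊗ {G} {H} (inj₁ g) (inj₂ e) =
  inj₁ (relabel (mkIso G (G ⊗ H) (absorbʳ e) (λ _ _ p → p) (λ _ _ p → p)) g)
OAT⁰-⊗ {G} {H} (inj₂ e) (inj₁ h) =
  inj₁ (relabel (mkIso H (G ⊗ H) (absorbˡ e) (λ _ _ p → p) (λ _ _ p → p)) h)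
OAT⁰-⊗         (inj₂ e) (inj₂ f) = inj₂ [ e , f ]

Kₙ : ℕ → Graph
Kₙ n = record { V = Fin n ; E = λ i j → ¬ i ≡ j ; sym = λ i≢j → i≢j ∘ Eq.sym
              ; irrefl = λ i≢i → i≢i refl ; dec = λ i j → ¬? (i FinP.≟ j)
              ; deq = FinP._≟_ }

K₁⊗Kₙ≅Kₙ₊₁ : ∀ n → (K₁ ⊗ Kₙ n) ≅ Kₙ (suc n)
K₁⊗Kₙ≅Kₙ₊₁ n = mkIso (K₁ ⊗ Kₙ n) (Kₙ (suc n)) β pres refl′
  where
  β : (⊤ ⊎ Fin n) ↔ Fin (suc n)
  β = mk↔ₛ′ [ (λ _ → zero) , suc ] (λ { zero → inj₁ tt ; (suc i) → inj₂ i })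
            (λ { zero → refl ; (suc _) → refl }) (λ { (inj₁ tt) → refl ; (inj₂ _) → refl })
  pres : ∀ x y → E (K₁ ⊗ Kₙ n) x y → E (Kₙ (suc n)) (Inverse.to β x) (Inverse.to β y)
  pres (inj₁ tt) (inj₁ tt) ()
  pres (inj₁ tt) (inj₂ j)  _ ()
  pres (inj₂ i)  (inj₁ tt) _ ()
  pres (inj₂ i)  (inj₂ j)  i≢j = i≢j ∘ FinP.suc-injective
  refl′ : ∀ x y → E (Kₙ (suc n)) (Inverse.to β x) (Inverse.to β y) → E (K₁ ⊗ Kₙ n) x y
  refl′ (inj₁ tt) (inj₁ tt) ne = ne refl
  refl′ (inj₁ tt) (inj₂ j)  _  = tt
  refl′ (inj₂ i)  (inj₁ tt) _  = tt
  refl′ (inj₂ i)  (inj₂ j)  ne = ne ∘ cong suc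

Kₙ-OAT⁰ : ∀ n → OAT⁰ (Kₙ n)
Kₙ-OAT⁰ zero    = inj₂ (λ ())
Kₙ-OAT⁰ (suc n) = OAT⁰-relabel (K₁⊗Kₙ≅Kₙ₊₁ n) (OAT⁰-⊗ (inj₁ single) (Kₙ-OAT⁰ n))

CompleteCut : (G : Graph) → (V G → Bool) → Set
CompleteCut G L = ∀ x y → T (L x) → T (not (L y)) → E G x y

CompleteCut-complement : ∀ G {L} → CompleteCut G L → CompleteCut G (not ∘ L)
CompleteCut-complement G {L} cut x y px py =
  sym G (cut y x (subst T (not-involutive (L y)) py) px)

CompleteCut-pullback : ∀ G H {L} (f : V H → V G) → (∀ x y → E G (f x) (f y) → E H x y) →
                       CompleteCut G L → CompleteCut H (L ∘ f)
CompleteCut-pullback G H f reflect cut x y px py = reflect x y (cut (f x) (f y) px py)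

join-decomposition : (G : Graph) (L : V G → Bool) → CompleteCut G L →
                     (induced G L ⊗ induced G (not ∘ L)) ≅ G
join-decomposition G L cut = mkIso (GL ⊗ GR) G (partition↔ L) pres refl′
  where
  GL = induced G L
  GR = induced G (not ∘ L)
  to = Inverse.to (partition↔ L)
  pres : ∀ x y → E (GL ⊗ GR) x y → E G (to x) (to y)
  pres (inj₁ _)       (inj₁ _)       e = e
  pres (inj₁ (x , p)) (inj₂ (y , q)) _ = cut x y p q
  pres (inj₂ (x , q)) (inj₁ (y , p)) _ = sym G (cut y x p q)
  pres (inj₂ _)       (inj₂ _)       e = e
  refl′ : ∀ x y → E G (to x) (to y) → E (GL ⊗ GR) x y
  refl′ (inj₁ _) (inj₁ _) e = e
  refl′ (inj₁ _) (inj₂ _) _ = tt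
  refl′ (inj₂ _) (inj₁ _) _ = tt
  refl′ (inj₂ _) (inj₂ _) e = e

induced-⊕ : ∀ G H (L : V (G ⊕ H) → Bool) →
            (induced G (L ∘ inj₁) ⊕ induced H (L ∘ inj₂)) ≅ induced (G ⊕ H) L
induced-⊕ G H L = mkIso _ (induced (G ⊕ H) L) (Sub-⊎↔ L) pres refl′
  where
  S = induced G (L ∘ inj₁) ⊕ induced H (L ∘ inj₂)
  to = Inverse.to (Sub-⊎↔ L)
  pres : ∀ x y → E S x y → E (induced (G ⊕ H) L) (to x) (to y)
  pres (inj₁ _) (inj₁ _) e = e
  pres (inj₂ _) (inj₂ _) e = e
  refl′ : ∀ x y → E (induced (G ⊕ H) L) (to x) (to y) → E S x y
  refl′ (inj₁ _) (inj₁ _) e = e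
  refl′ (inj₂ _) (inj₂ _) e = e

induced-⊗ : ∀ G H (L : V (G ⊗ H) → Bool) →
            (induced G (L ∘ inj₁) ⊗ induced H (L ∘ inj₂)) ≅ induced (G ⊗ H) L
induced-⊗ G H L = mkIso _ (induced (G ⊗ H) L) (Sub-⊎↔ L) pres refl′
  where
  S = induced G (L ∘ inj₁) ⊗ induced H (L ∘ inj₂)
  to = Inverse.to (Sub-⊎↔ L)
  pres : ∀ x y → E S x y → E (induced (G ⊗ H) L) (to x) (to y)
  pres (inj₁ _) (inj₁ _) e = e
  pres (inj₁ _) (inj₂ _) e = e
  pres (inj₂ _) (inj₁ _) e = e
  pres (inj₂ _) (inj₂ _) e = e
  refl′ : ∀ x y → E (induced (G ⊗ H) L) (to x) (to y) → E S x y
  refl′ (inj₁ _) (inj₁ _) e = e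
  refl′ (inj₁ _) (inj₂ _) e = e
  refl′ (inj₂ _) (inj₁ _) e = e
  refl′ (inj₂ _) (inj₂ _) e = e

induced-relabel : ∀ {G H} (i : G ≅ H) (L : V H → Bool) →
                  induced G (L ∘ Inverse.to (_≅_.bij i)) ≅ induced H L
induced-relabel {G} {H} i L = mkIso _ _ β
  (λ (x , _) (y , _) → Equivalence.to (_≅_.preserves i x y))
  (λ (x , _) (y , _) → Equivalence.from (_≅_.preserves i x y))
  where
  open Inverse (_≅_.bij i)
  β : Sub (L ∘ to) ↔ Sub L
  β = mk↔ₛ′ (λ (x , p) → to x , p)
            (λ (y , p) → from y , subst (T ∘ L) (Eq.sym (strictlyInverseˡ y)) p)
            (λ (y , _) → sub-≡ (strictlyInverseˡ y))
            (λ (x , _) → sub-≡ (strictlyInverseʳ x))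

induced-K₁ : (L : ⊤ → Bool) → OAT⁰ (induced K₁ L)
induced-K₁ L with T? (L tt)
... | yes p = inj₁ (relabel (mkIso K₁ (induced K₁ L) β (λ _ _ ()) (λ _ _ ())) single)
  where
  β : ⊤ ↔ Sub L
  β = mk↔ₛ′ (λ _ → tt , p) (λ _ → tt) (λ (tt , _) → sub-≡ refl) (λ _ → refl)
... | no ¬p = inj₂ (λ (tt , p) → ¬p p)

module NewVertex (G : Graph) (X : V G → Bool) (L : V (addVertex G X) → Bool) where
  G′ = addVertex G X
  GL = induced G (L ∘ just)

  outside : ¬ T (L nothing) → GL ≅ induced G′ L
  outside ¬pu = mkIso GL (induced G′ L) β (λ _ _ e → e) (λ _ _ e → e)
    where
    from : Sub L → Sub (L ∘ just)
    from (just x  , p)  = x , p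
    from (nothing , pu) = contradiction pu ¬pu
    β : Sub (L ∘ just) ↔ Sub L
    β = mk↔ₛ′ (λ (x , p) → just x , p) from
              (λ { (just _ , _) → refl ; (nothing , pu) → contradiction pu ¬pu }) (λ _ → refl)

  inside : T (L nothing) → addVertex GL (X ∘ proj₁) ≅ induced G′ L
  inside pu = mkIso A (induced G′ L) β pres refl′
    where
    A = addVertex GL (X ∘ proj₁)
    to : V A → Sub L
    to nothing        = nothing , pu
    to (just (x , p)) = just x , p
    from : Sub L → V A
    from (nothing , _) = nothing
    from (just x  , p) = just (x , p)
    β : V A ↔ Sub L
    β = mk↔ₛ′ to from (λ { (nothing , _) → sub-≡ refl ; (just _ , _) → refl })
                      (λ { nothing → refl ; (just _) → refl })
    pres : ∀ x y → E A x y → E (induced G′ L) (to x) (to y)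
    pres nothing  (just _) e = e
    pres (just _) nothing  e = e
    pres (just _) (just _) e = e
    refl′ : ∀ x y → E (induced G′ L) (to x) (to y) → E A x y
    refl′ nothing  (just _) e = e
    refl′ (just _) nothing  e = e
    refl′ (just _) (just _) e = e

  -- Inductive step for a comparable vertex u with N(u) = X ⊆ N(v).  A complete
  -- cut cannot contain u but not v, since u and v are not adjacent.
  induced-addVertex : (v : V G) → (∀ x → T (X x) → E G v x) → CompleteCut G′ L →
                      OAT⁰ GL → OAT⁰ (induced G′ L)
  induced-addVertex v X⊆Nv cut ih with T? (L nothing) | T-or-not (L (just v))
  ... | no ¬pu | _ =
    OAT⁰-relabel (outside ¬pu) ih
  ... | yes pu | inj₁ pv =
    inj₁ (relabel (inside pu)
      (comparable (OAT⁰-nonempty ih (v , pv)) (v , pv) (X ∘ proj₁) (X⊆Nv ∘ proj₁)))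
  ... | yes pu | inj₂ ¬pv =
    contradiction (X⊆Nv v (cut nothing (just v) pu ¬pv)) (irrefl G)

open NewVertex using (induced-addVertex)

-- Let φ enumerate Q ∩ L by Fin m.  If Q ∩ L is
-- nonempty and v ∈ L, then G′[L] is G[L] with Q ∩ L attached at v; otherwise
-- no edge of G′[L] joins G to Q, and G′[L] is the union G[L] ⊕ K_m.
module AttachedClique (G : Graph) (v : V G) (k : ℕ) (L : V (attachClique G v k) → Bool) where
  G′ = attachClique G v k
  GL = induced G (L ∘ inj₁)

  β : ∀ {m} → Sub (L ∘ inj₂) ↔ Fin m → (V GL ⊎ Fin m) ↔ V (induced G′ L)
  β φ = ↔-trans (↔-refl ⊎-↔ ↔-sym φ) (Sub-⊎↔ L)

  labels-distinct : ∀ {m} (φ : Sub (L ∘ inj₂) ↔ Fin m) {i j : Fin m} → ¬ i ≡ j →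
                    ¬ proj₁ (Inverse.from φ i) ≡ proj₁ (Inverse.from φ j)
  labels-distinct φ i≢j eq = i≢j (Injection.injective (↔⇒↣ (↔-sym φ)) (sub-≡ eq))

  vertices-distinct : ∀ {m} (φ : Sub (L ∘ inj₂) ↔ Fin m) {i j : Fin m} →
                      ¬ proj₁ (Inverse.from φ i) ≡ proj₁ (Inverse.from φ j) → ¬ i ≡ j
  vertices-distinct φ ne = ne ∘ cong (proj₁ ∘ Inverse.from φ)

  detached : ∀ {m} (φ : Sub (L ∘ inj₂) ↔ Fin m) → (T (L (inj₁ v)) → ¬ Fin m) →
             (GL ⊕ Kₙ m) ≅ induced G′ L
  detached {m} φ apart = mkIso (GL ⊕ Kₙ m) (induced G′ L) (β φ) pres refl′
    where
    to = Inverse.to (β φ)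
    pres : ∀ x y → E (GL ⊕ Kₙ m) x y → E (induced G′ L) (to x) (to y)
    pres (inj₁ _) (inj₁ _) e = e
    pres (inj₂ _) (inj₂ _) e = labels-distinct φ e
    refl′ : ∀ x y → E (induced G′ L) (to x) (to y) → E (GL ⊕ Kₙ m) x y
    refl′ (inj₁ _)       (inj₁ _)       e    = e
    refl′ (inj₁ (x , p)) (inj₂ j)       refl = apart p j
    refl′ (inj₂ i)       (inj₁ (y , p)) refl = apart p i
    refl′ (inj₂ _)       (inj₂ _)       e    = vertices-distinct φ e

  attached : ∀ {m} (φ : Sub (L ∘ inj₂) ↔ Fin (suc m)) (pv : T (L (inj₁ v))) →
             attachClique GL (v , pv) m ≅ induced G′ L
  attached {m} φ pv = mkIso A (induced G′ L) (β φ) pres refl′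
    where
    A = attachClique GL (v , pv) m
    to = Inverse.to (β φ)
    pres : ∀ x y → E A x y → E (induced G′ L) (to x) (to y)
    pres (inj₁ _) (inj₁ _) e = e
    pres (inj₁ _) (inj₂ _) e = cong proj₁ e
    pres (inj₂ _) (inj₁ _) e = cong proj₁ e
    pres (inj₂ _) (inj₂ _) e = labels-distinct φ e
    refl′ : ∀ x y → E (induced G′ L) (to x) (to y) → E A x y
    refl′ (inj₁ _) (inj₁ _) e = e
    refl′ (inj₁ _) (inj₂ _) e = sub-≡ e
    refl′ (inj₂ _) (inj₁ _) e = sub-≡ e
    refl′ (inj₂ _) (inj₂ _) e = vertices-distinct φ e

  induced-attachClique : OAT⁰ GL → OAT⁰ (induced G′ L)
  induced-attachClique ih with count (suc k) (L ∘ inj₂) | T? (L (inj₁ v))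
  ... | suc m , φ | yes pv =
    inj₁ (relabel (attached φ pv) (clique (OAT⁰-nonempty ih (v , pv)) (v , pv) m))
  ... | zero  , φ | yes _ =
    OAT⁰-relabel (detached φ (λ _ ())) (OAT⁰-⊕ ih (Kₙ-OAT⁰ zero))
  ... | m     , φ | no ¬pv =
    OAT⁰-relabel (detached φ (λ pv _ → ¬pv pv)) (OAT⁰-⊕ ih (Kₙ-OAT⁰ m))

open AttachedClique using (induced-attachClique)

induced-OAT⁰ : ∀ {G} → OAT G → (L : V G → Bool) → CompleteCut G L → OAT⁰ (induced G L)
induced-OAT⁰ single L _ = induced-K₁ L
induced-OAT⁰ (union {G} {H} oG oH) L cut =
  OAT⁰-relabel (induced-⊕ G H L) (OAT⁰-⊕ (induced-OAT⁰ oG _ cutG) (induced-OAT⁰ oH _ cutH))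
  where
  cutG : CompleteCut G (L ∘ inj₁)
  cutG = CompleteCut-pullback (G ⊕ H) G inj₁ (λ _ _ e → e) cut
  cutH : CompleteCut H (L ∘ inj₂)
  cutH = CompleteCut-pullback (G ⊕ H) H inj₂ (λ _ _ e → e) cut
induced-OAT⁰ (join {G} {H} oG oH) L cut =
  OAT⁰-relabel (induced-⊗ G H L) (OAT⁰-⊗ (induced-OAT⁰ oG _ cutG) (induced-OAT⁰ oH _ cutH))
  where
  cutG : CompleteCut G (L ∘ inj₁)
  cutG = CompleteCut-pullback (G ⊗ H) G inj₁ (λ _ _ e → e) cut
  cutH : CompleteCut H (L ∘ inj₂)
  cutH = CompleteCut-pullback (G ⊗ H) H inj₂ (λ _ _ e → e) cut
induced-OAT⁰ (comparable {G} o v X X⊆Nv) L cut =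
  induced-addVertex G X L v X⊆Nv cut (induced-OAT⁰ o _ cutG)
  where
  cutG : CompleteCut G (L ∘ just)
  cutG = CompleteCut-pullback (addVertex G X) G just (λ _ _ e → e) cut
induced-OAT⁰ (clique {G} o v k) L cut =
  induced-attachClique G v k L (induced-OAT⁰ o _ cutG)
  where
  cutG : CompleteCut G (L ∘ inj₁)
  cutG = CompleteCut-pullback (attachClique G v k) G inj₁ (λ _ _ e → e) cut
induced-OAT⁰ (relabel {G} {H} i o) L cut =
  OAT⁰-relabel (induced-relabel i L) (induced-OAT⁰ o _ cutG)
  where
  to = Inverse.to (_≅_.bij i)
  cutG : CompleteCut G (L ∘ to)
  cutG = CompleteCut-pullback H G to (λ x y → Equivalence.from (_≅_.preserves i x y)) cut

-- Lemma 6: if L and its complement are nonempty and form a complete cut,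
-- then G is OAT iff G[L] and G[V ∖ L] are.
lemma6 : (G : Graph) → Finite G → (L : V G → Bool) →
         ∃ (λ x → T (L x)) → ∃ (λ y → T (not (L y))) →
         (∀ x y → T (L x) → T (not (L y)) → E G x y) →
         OAT G ⇔ (OAT (induced G L) × OAT (induced G (λ y → not (L y))))
lemma6 G _ L x∈L y∉L cut = mk⇔ sides glue
  where
  sides : OAT G → OAT (induced G L) × OAT (induced G (not ∘ L))
  sides o = OAT⁰-nonempty (induced-OAT⁰ o L cut) x∈L
          , OAT⁰-nonempty (induced-OAT⁰ o (not ∘ L) (CompleteCut-complement G cut)) y∉L
  glue : OAT (induced G L) × OAT (induced G (not ∘ L)) → OAT G
  glue (oL , oR) = relabel (join-decomposition G L cut) (join oL oR)
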